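{- Let $G$ be a group with subgroups $G_1,G_2,H$, and suppose that either $H$ or $G_1\cap G_2$ is normal in $G$. If $H\cap G_1=H\cap G_2\subsetneq H$, then $$\langle H,G_1\cap G_2\rangle\cap G_1=\langle H,G_1\cap G_2\rangle\cap G_2\subsetneq \langle H,G_1\cap G_2\rangle.$$ -}

module Defs where

open import Level using (Level; _⊔_; suc)
open import Algebra.Bundles using (Group)
open import Data.Product using (_×_; _,_; ∃-syntax)
open import Data.Sum using (_⊎_)
open import Relation.Nullary using (¬_)

module _ {c ℓ : Level} (G : Group c ℓ) where
  open Group G

  Subset : (p : Level) → Set (c ⊔ suc p)
  Subset p = Carrier → Set p

  record IsSubgroup {p : Level} (S : Subset p) : Set (c ⊔ ℓ ⊔ p) where
    field
      resp  : ∀ {x y} → x ≈ y → S x → S y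
      ε-mem : S ε
      ∙-mem : ∀ {x y} → S x → S y → S (x ∙ y)
      ⁻¹-mem : ∀ {x} → S x → S (x ⁻¹)

  record IsNormalSubgroup {p : Level} (S : Subset p) : Set (c ⊔ ℓ ⊔ p) where
    field
      isSubgroup : IsSubgroup S
      conj-mem   : ∀ g {x} → S x → S ((g ∙ x) ∙ (g ⁻¹))

  _∩_ : ∀ {p q} → Subset p → Subset q → Subset (p ⊔ q)
  (S ∩ T) x = S x × T x

  _∪_ : ∀ {p q} → Subset p → Subset q → Subset (p ⊔ q)
  (S ∪ T) x = S x ⊎ T x

  _⊆_ : ∀ {p q} → Subset p → Subset q → Set (c ⊔ p ⊔ q)
  S ⊆ T = ∀ {x} → S x → T x

  _≐_ : ∀ {p q} → Subset p → Subset q → Set (c ⊔ p ⊔ q)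
  S ≐ T = (S ⊆ T) × (T ⊆ S)

  _⊊_ : ∀ {p q} → Subset p → Subset q → Set (c ⊔ p ⊔ q)
  S ⊊ T = (S ⊆ T) × (∃[ x ] (T x × ¬ S x))

  data ⟨_⟩ {p : Level} (S : Subset p) : Carrier → Set (c ⊔ ℓ ⊔ p) where
    gen  : ∀ {x} → S x → ⟨ S ⟩ x
    unit : ⟨ S ⟩ ε
    mul  : ∀ {x y} → ⟨ S ⟩ x → ⟨ S ⟩ y → ⟨ S ⟩ (x ∙ y)
    inv  : ∀ {x} → ⟨ S ⟩ x → ⟨ S ⟩ (x ⁻¹)
    resp : ∀ {x y} → x ≈ y → ⟨ S ⟩ x → ⟨ S ⟩ y

{-# OPTIONS --safe #-}
module Submission where

-- If H or K = G₁ ∩ G₂ is normal, the product set H K is a subgroup, so it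
-- contains the join ⟨H ∪ K⟩.
-- For x = h k ∈ G₁ with h ∈ H, k ∈ K we get h = x k⁻¹ ∈ H ∩ G₁ = H ∩ G₂, so
-- x ∈ G₂; and an element of H outside G₁ stays outside G₁ inside the join.

open import Defs
open import Level using (Level; _⊔_)
open import Algebra.Bundles using (Group)
open import Data.Product using (_×_; _,_; ∃-syntax; proj₁; proj₂)
open import Data.Sum using (_⊎_; inj₁; inj₂)
import Algebra.Properties.Group as GroupProperties
import Relation.Binary.Reasoning.Setoid as SetoidReasoning

module _ {c ℓ : Level} (G : Group c ℓ) where
  open Group G
  open GroupProperties G
  open SetoidReasoning setoid

  private variable
    S T H K A B : Subset G _

  _·_ : ∀ {p q} → Subset G p → Subset G q → Subset G (c ⊔ ℓ ⊔ p ⊔ q)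
  (S · T) x = ∃[ s ] ∃[ t ] (S s × T t × x ≈ s ∙ t)

  ∩-isSubgroup : IsSubgroup G S → IsSubgroup G T → IsSubgroup G (_∩_ G S T)
  ∩-isSubgroup sS sT = record
    { resp   = λ e (s , t) → S.resp e s , T.resp e t
    ; ε-mem  = S.ε-mem , T.ε-mem
    ; ∙-mem  = λ (s , t) (s′ , t′) → S.∙-mem s s′ , T.∙-mem t t′
    ; ⁻¹-mem = λ (s , t) → S.⁻¹-mem s , T.⁻¹-mem t
    }
    where
    module S = IsSubgroup sS
    module T = IsSubgroup sT

  isSubgroup-// : (∀ {x y} → x ≈ y → S x → S y) → S ε →
                  (∀ {x y} → S x → S y → S (x // y)) → IsSubgroup G S
  isSubgroup-// {S = S} S-resp ε∈S //∈S = record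
    { resp   = S-resp
    ; ε-mem  = ε∈S
    ; ∙-mem  = λ s t → S-resp (∙-congˡ (⁻¹-involutive _)) (//∈S s (⁻¹∈S t))
    ; ⁻¹-mem = ⁻¹∈S
    }
    where
    ⁻¹∈S : ∀ {x} → S x → S (x ⁻¹)
    ⁻¹∈S s = S-resp (identityˡ _) (//∈S ε∈S s)

  ⟨⟩-least : IsSubgroup G T → _⊆_ G S T → _⊆_ G (⟨_⟩ G S) T
  ⟨⟩-least sT S⊆T (gen s)    = S⊆T s
  ⟨⟩-least sT S⊆T unit       = IsSubgroup.ε-mem sT
  ⟨⟩-least sT S⊆T (mul s t)  = IsSubgroup.∙-mem sT (⟨⟩-least sT S⊆T s) (⟨⟩-least sT S⊆T t)
  ⟨⟩-least sT S⊆T (inv s)    = IsSubgroup.⁻¹-mem sT (⟨⟩-least sT S⊆T s)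
  ⟨⟩-least sT S⊆T (resp e s) = IsSubgroup.resp sT e (⟨⟩-least sT S⊆T s)

  ∪⊆· : IsSubgroup G S → IsSubgroup G T → _⊆_ G (_∪_ G S T) (S · T)
  ∪⊆· sS sT (inj₁ s) = _ , ε , s , IsSubgroup.ε-mem sT , sym (identityʳ _)
  ∪⊆· sS sT (inj₂ t) = ε , _ , IsSubgroup.ε-mem sS , t , sym (identityˡ _)

  ·-sandwich : IsSubgroup G H → IsSubgroup G K →
               IsNormalSubgroup G H ⊎ IsNormalSubgroup G K →
               ∀ {h₁ k h₂} → H h₁ → K k → H h₂ → (H · K) (h₁ ∙ k ∙ h₂)
  ·-sandwich sH sK (inj₁ nH) {h₁} {k} {h₂} h₁∈H k∈K h₂∈H =
    h₁ ∙ (k ∙ h₂ // k) , k ,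
    IsSubgroup.∙-mem sH h₁∈H (IsNormalSubgroup.conj-mem nH k h₂∈H) , k∈K ,
    (begin
      h₁ ∙ k ∙ h₂              ≈⟨ assoc h₁ k h₂ ⟩
      h₁ ∙ (k ∙ h₂)            ≈⟨ ∙-congˡ (//-rightDividesˡ k (k ∙ h₂)) ⟨
      h₁ ∙ ((k ∙ h₂ // k) ∙ k) ≈⟨ assoc h₁ (k ∙ h₂ // k) k ⟨
      h₁ ∙ (k ∙ h₂ // k) ∙ k   ∎)
  ·-sandwich sH sK (inj₂ nK) {h₁} {k} {h₂} h₁∈H k∈K h₂∈H =
    h₁ ∙ h₂ , h₂ \\ (k ∙ h₂) ,
    IsSubgroup.∙-mem sH h₁∈H h₂∈H ,
    IsSubgroup.resp sK (trans (∙-congˡ (⁻¹-involutive h₂)) (assoc (h₂ ⁻¹) k h₂))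
      (IsNormalSubgroup.conj-mem nK (h₂ ⁻¹) k∈K) ,
    (begin
      h₁ ∙ k ∙ h₂                  ≈⟨ assoc h₁ k h₂ ⟩
      h₁ ∙ (k ∙ h₂)                ≈⟨ ∙-congˡ (\\-leftDividesˡ h₂ (k ∙ h₂)) ⟨
      h₁ ∙ (h₂ ∙ (h₂ \\ (k ∙ h₂))) ≈⟨ assoc h₁ h₂ (h₂ \\ (k ∙ h₂)) ⟨
      h₁ ∙ h₂ ∙ (h₂ \\ (k ∙ h₂))   ∎)

  ·-isSubgroup : IsSubgroup G H → IsSubgroup G K →
                 IsNormalSubgroup G H ⊎ IsNormalSubgroup G K → IsSubgroup G (H · K)
  ·-isSubgroup {H = H} {K = K} sH sK normal =
    isSubgroup-// resp· (ε , ε , H.ε-mem , K.ε-mem , sym (identityˡ ε)) //∈HK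
    where
    module H = IsSubgroup sH
    module K = IsSubgroup sK

    resp· : ∀ {x y} → x ≈ y → (H · K) x → (H · K) y
    resp· x≈y (h , k , h∈H , k∈K , x≈hk) = h , k , h∈H , k∈K , trans (sym x≈y) x≈hk

    regroup : ∀ h₁ k₁ h₂ k₂ → h₁ ∙ k₁ // (h₂ ∙ k₂) ≈ h₁ ∙ (k₁ // k₂) ∙ h₂ ⁻¹
    regroup h₁ k₁ h₂ k₂ = begin
      h₁ ∙ k₁ ∙ (h₂ ∙ k₂) ⁻¹        ≈⟨ ∙-congˡ (⁻¹-anti-homo-∙ h₂ k₂) ⟩
      h₁ ∙ k₁ ∙ (k₂ ⁻¹ ∙ h₂ ⁻¹)     ≈⟨ assoc (h₁ ∙ k₁) (k₂ ⁻¹) (h₂ ⁻¹) ⟨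
      h₁ ∙ k₁ ∙ k₂ ⁻¹ ∙ h₂ ⁻¹       ≈⟨ ∙-congʳ (assoc h₁ k₁ (k₂ ⁻¹)) ⟩
      h₁ ∙ (k₁ ∙ k₂ ⁻¹) ∙ h₂ ⁻¹     ∎

    //∈HK : ∀ {x y} → (H · K) x → (H · K) y → (H · K) (x // y)
    //∈HK (h₁ , k₁ , h₁∈H , k₁∈K , x≈h₁k₁) (h₂ , k₂ , h₂∈H , k₂∈K , y≈h₂k₂) =
      resp· (sym (trans (//-cong₂ x≈h₁k₁ y≈h₂k₂) (regroup h₁ k₁ h₂ k₂)))
        (·-sandwich sH sK normal h₁∈H (K.∙-mem k₁∈K (K.⁻¹-mem k₂∈K)) (H.⁻¹-mem h₂∈H))

  ∩⊆⇒·∩⊆ : IsSubgroup G A → IsSubgroup G B → _⊆_ G K A → _⊆_ G K B →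
           _⊆_ G (_∩_ G H A) B → _⊆_ G (_∩_ G (H · K) A) B
  ∩⊆⇒·∩⊆ {A = A} {B = B} sA sB K⊆A K⊆B H∩A⊆B ((h , k , h∈H , k∈K , x≈hk) , x∈A) =
    IsSubgroup.resp sB (sym x≈hk) (IsSubgroup.∙-mem sB h∈B (K⊆B k∈K))
    where
    h∈A : A h
    h∈A = IsSubgroup.resp sA (trans (∙-congʳ x≈hk) (//-rightDividesʳ k h))
            (IsSubgroup.∙-mem sA x∈A (IsSubgroup.⁻¹-mem sA (K⊆A k∈K)))
    h∈B : B h
    h∈B = H∩A⊆B (h∈H , h∈A)

proposition3p11 : ∀ {c ℓ p : Level} (G : Group c ℓ)
    (G₁ G₂ H : Subset G p) →
    IsSubgroup G G₁ → IsSubgroup G G₂ → IsSubgroup G H →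
    (IsNormalSubgroup G H ⊎ IsNormalSubgroup G (_∩_ G G₁ G₂)) →
    _≐_ G (_∩_ G H G₁) (_∩_ G H G₂) →
    _⊊_ G (_∩_ G H G₁) H →
    _≐_ G (_∩_ G (⟨_⟩ G (_∪_ G H (_∩_ G G₁ G₂))) G₁) (_∩_ G (⟨_⟩ G (_∪_ G H (_∩_ G G₁ G₂))) G₂)
      × _⊊_ G (_∩_ G (⟨_⟩ G (_∪_ G H (_∩_ G G₁ G₂))) G₁) (⟨_⟩ G (_∪_ G H (_∩_ G G₁ G₂)))
proposition3p11 G G₁ G₂ H sG₁ sG₂ sH normal (H∩G₁⊆H∩G₂ , H∩G₂⊆H∩G₁) (_ , h , h∈H , h∉H∩G₁) =
  ( (λ (l , x∈G₁) → l , ∩⊆⇒·∩⊆ G sG₁ sG₂ proj₁ proj₂ H∩G₁⊆G₂ (join⊆HK l , x∈G₁))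
  , (λ (l , x∈G₂) → l , ∩⊆⇒·∩⊆ G sG₂ sG₁ proj₂ proj₁ H∩G₂⊆G₁ (join⊆HK l , x∈G₂)) )
  , proj₁ , h , gen (inj₁ h∈H) , λ (_ , h∈G₁) → h∉H∩G₁ (h∈H , h∈G₁)
  where
  K : Subset G _
  K = _∩_ G G₁ G₂

  join⊆HK : _⊆_ G (⟨_⟩ G (_∪_ G H K)) (_·_ G H K)
  join⊆HK = ⟨⟩-least G (·-isSubgroup G sH (∩-isSubgroup G sG₁ sG₂) normal)
                       (∪⊆· G sH (∩-isSubgroup G sG₁ sG₂))

  H∩G₁⊆G₂ : _⊆_ G (_∩_ G H G₁) G₂
  H∩G₁⊆G₂ x∈H∩G₁ = proj₂ (H∩G₁⊆H∩G₂ x∈H∩G₁)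

  H∩G₂⊆G₁ : _⊆_ G (_∩_ G H G₂) G₁
  H∩G₂⊆G₁ x∈H∩G₂ = proj₂ (H∩G₂⊆H∩G₁ x∈H∩G₂)
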